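{- For every positive integer $n$, $$\rho(n)\le \chi_{\mu}\big(S(K_n)\big)\le \chi_{\mu_i}\big(S(K_n)\big)\le \rho(n)+1,$$ where $\rho(n)$ is the smallest number of sets in a $K_4$-free partition of the complete graph $K_n$ and $S(K_n)$ is the subdivision graph of $K_n$.
   Context: All graphs are finite and simple. A geodesic is a shortest path. For a graph $G$ and $X\subseteq V(G)$, two vertices $x,y\in X$ are $X$-visible if there is an $x,y$-geodesic none of whose internal vertices lies in $X$; $X$ is a mutual-visibility (MV) set if every two vertices of $X$ are $X$-visible, and an independent mutual-visibility (IMV) set if moreover $X$ is independent. A map $c:V(G)\to[k]$ is an MV $k$-coloring (resp. IMV $k$-coloring) if every color class $c^{ -1}(i)$ is an MV set (resp. IMV set). $\chi_\mu(G)$ (resp. $\chi_{\mu_i}(G)$) is the least $k$ for which $G$ has an MV $k$-coloring (resp. IMV $k$-coloring). The subdivision graph $S(G)$ is obtained from $G$ by replacing every edge $uv$ by a path $u\,e_{uv}\,v$ through a new vertex $e_{uv}$. A graph is $H$-free if it has no subgraph isomorphic to $H$. For $F\subseteq E(G)$, $\langle F\rangle$ denotes the subgraph formed by the edges of $F$ and their endvertices. An $H$-free partition of $G$ is a partition $\{P_1,\dots,P_r\}$ of $E(G)$ such that each $\langle P_i\rangle$ is $H$-free. -}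

module Defs where

open import Data.Nat using (ℕ; zero; suc; _≤_)
open import Data.Fin using (Fin; _≟_) renaming (_<_ to _<ᶠ_)
open import Data.Bool using (Bool; true; false; not; T)
open import Data.Product using (Σ; _×_; _,_; proj₁; proj₂)
open import Data.Sum using (_⊎_; inj₁; inj₂)
open import Data.Empty using (⊥)
open import Data.Unit using (⊤)
open import Relation.Nullary using (¬_; does; yes; no)
open import Relation.Binary.PropositionalEquality using (_≡_; _≢_; refl; sym)

record Graph : Set₁ where
  field
    V      : Set
    _~_    : V → V → Set
    ~-sym  : ∀ {x y} → x ~ y → y ~ x
    ~-irr  : ∀ {x} → ¬ (x ~ x)

record FinGraph (N : ℕ) : Set where
  field
    adj     : Fin N → Fin N → Bool
    adj-sym : ∀ u v → adj u v ≡ adj v u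
    adj-irr : ∀ u → adj u u ≡ false

-- Edges of a finite graph, each unordered edge {a,b} represented once (a < b)
Edge : ∀ {N} → FinGraph N → Set
Edge {N} G = Σ (Fin N × Fin N) λ p → (proj₁ p <ᶠ proj₂ p) × T (FinGraph.adj G (proj₁ p) (proj₂ p))

private
  ≟-refl-false : ∀ {n} (u : Fin n) → not (does (u ≟ u)) ≡ false
  ≟-refl-false u with u ≟ u
  ... | yes _ = refl
  ... | no ¬p = Data.Empty.⊥-elim (¬p refl)
    where import Data.Empty

  ≟-sym : ∀ {n} (u v : Fin n) → not (does (u ≟ v)) ≡ not (does (v ≟ u))
  ≟-sym u v with u ≟ v | v ≟ u
  ... | yes _ | yes _ = refl
  ... | no _  | no _  = refl
  ... | yes p | no ¬q = Data.Empty.⊥-elim (¬q (sym p))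
    where import Data.Empty
  ... | no ¬p | yes q = Data.Empty.⊥-elim (¬p (sym q))
    where import Data.Empty

K : (n : ℕ) → FinGraph n
K n = record
  { adj     = λ u v → not (does (u ≟ v))
  ; adj-sym = ≟-sym
  ; adj-irr = ≟-refl-false
  }

module _ {N : ℕ} (G : FinGraph N) where
  Incident : Fin N → Edge G → Set
  Incident u ((a , b) , _) = (u ≡ a) ⊎ (u ≡ b)

  SAdj : Fin N ⊎ Edge G → Fin N ⊎ Edge G → Set
  SAdj (inj₁ u) (inj₁ v) = ⊥
  SAdj (inj₁ u) (inj₂ e) = Incident u e
  SAdj (inj₂ e) (inj₁ u) = Incident u e
  SAdj (inj₂ e) (inj₂ f) = ⊥

  SAdj-sym : ∀ {x y} → SAdj x y → SAdj y x
  SAdj-sym {inj₁ u} {inj₂ e} p = p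
  SAdj-sym {inj₂ e} {inj₁ u} p = p

  SAdj-irr : ∀ {x} → ¬ SAdj x x
  SAdj-irr {inj₁ u} ()
  SAdj-irr {inj₂ e} ()

S : ∀ {N} → FinGraph N → Graph
S G = record
  { V = _ ⊎ Edge G
  ; _~_ = SAdj G
  ; ~-sym = SAdj-sym G
  ; ~-irr = SAdj-irr G
  }

module _ (G : Graph) where
  open Graph G

  data Walk : V → V → ℕ → Set where
    nil  : ∀ {x} → Walk x x 0
    cons : ∀ {x y z ℓ} → x ~ y → Walk y z ℓ → Walk x z (suc ℓ)

  IsGeodesic : ∀ {x y ℓ} → Walk x y ℓ → Set
  IsGeodesic {x} {y} {ℓ} _ = ∀ ℓ' → suc ℓ' ≤ ℓ → ¬ Walk x y ℓ'

  InternalAvoid : (V → Set) → ∀ {x y ℓ} → Walk x y ℓ → Set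
  InternalAvoid X nil = ⊤
  InternalAvoid X (cons _ nil) = ⊤
  InternalAvoid X (cons {y = y} _ w@(cons _ _)) = ¬ X y × InternalAvoid X w

  Visible : (V → Set) → V → V → Set
  Visible X x y = Σ ℕ λ ℓ → Σ (Walk x y ℓ) λ w → IsGeodesic w × InternalAvoid X w

  IsMV : (V → Set) → Set
  IsMV X = ∀ x y → X x → X y → Visible X x y

  IsIndependent : (V → Set) → Set
  IsIndependent X = ∀ x y → X x → X y → ¬ (x ~ y)

  IsIMV : (V → Set) → Set
  IsIMV X = IsMV X × IsIndependent X

  ColourClass : ∀ {k} → (V → Fin k) → Fin k → V → Set
  ColourClass c i v = c v ≡ i

  HasMVColouring : ℕ → Set
  HasMVColouring k = Σ (V → Fin k) λ c → ∀ i → IsMV (ColourClass c i)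

  HasIMVColouring : ℕ → Set
  HasIMVColouring k = Σ (V → Fin k) λ c → ∀ i → IsIMV (ColourClass c i)

module _ {N : ℕ} (G : FinGraph N) where
  EdgeInClass : ∀ {r} → (Edge G → Fin r) → Fin r → Fin N → Fin N → Set
  EdgeInClass f i a b =
      (Σ (a <ᶠ b) λ p → Σ (T (FinGraph.adj G a b)) λ q → f ((a , b) , p , q) ≡ i)
    ⊎ (Σ (b <ᶠ a) λ p → Σ (T (FinGraph.adj G b a)) λ q → f ((b , a) , p , q) ≡ i)

  ClassContainsK4 : ∀ {r} → (Edge G → Fin r) → Fin r → Set
  ClassContainsK4 f i =
    Σ (Fin N) λ a → Σ (Fin N) λ b → Σ (Fin N) λ c → Σ (Fin N) λ d →
      (a ≢ b) × (a ≢ c) × (a ≢ d) × (b ≢ c) × (b ≢ d) × (c ≢ d) ×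
      EdgeInClass f i a b × EdgeInClass f i a c × EdgeInClass f i a d ×
      EdgeInClass f i b c × EdgeInClass f i b d × EdgeInClass f i c d

  -- a K4-free partition of E(G) into (at most) r classes
  HasK4FreePartition : ℕ → Set
  HasK4FreePartition r = Σ (Edge G → Fin r) λ f → ∀ i → ¬ ClassContainsK4 f i

IsLeast : (ℕ → Set) → ℕ → Set
IsLeast P m = P m × (∀ k → P k → m ≤ k)

-- For disjoint edges ab and cd the edge vertices e_ab and e_cd of S(G) are at
-- distance 4, and every geodesic between them is e_ab, x, e_xy, y, e_cd with
-- x ∈ {a, b} and y ∈ {c, d}. So if the edge vertices of one class of an MV
-- colouring spanned a K₄ on abcd, e_ab and e_cd would only be joined through
-- edge vertices of their own class: restricting an MV colouring to the edge
-- vertices gives a K₄-free partition, whence ρ ≤ χ_μ. Conversely, colour all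
-- original vertices with a fresh colour and e_uv with the class of uv. Original
-- vertices u, v see each other through e_uv, edge vertices sharing an endpoint
-- through it, and for disjoint ab, cd of one class some cross edge among
-- ac, ad, bc, bd lies in another class, as the class is K₄-free; this gives an
-- IMV colouring with ρ + 1 colours.
module Submission where

open import Defs
open import Data.Nat using (ℕ; suc; _≤_; _<_; s≤s)
import Data.Nat.Properties as ℕ
open import Data.Fin using (Fin; zero; suc; _≟_)
open import Data.Fin.Properties using (<-cmp; <-irrelevant; <-asym; <⇒≢; suc-injective)
open import Data.Bool using (T)
open import Data.Bool.Properties using (T-irrelevant)
open import Data.Product using (Σ; _×_; _,_; proj₁)
open import Data.Product.Properties using (≡-dec)
open import Data.Sum using (_⊎_; inj₁; inj₂)
open import Data.Empty using (⊥-elim)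
open import Data.Unit using (tt)
open import Function using (_∘_)
open import Relation.Nullary using (¬_; yes; no)
open import Relation.Binary using (tri<; tri≈; tri>)
open import Relation.Binary.PropositionalEquality using (_≡_; _≢_; refl; sym; subst)

module _ (G : Graph) where
  open Graph G

  geodesic-length-unique : ∀ {x y ℓ m} (w : Walk G x y ℓ) (w′ : Walk G x y m) →
    IsGeodesic G w → IsGeodesic G w′ → ℓ ≡ m
  geodesic-length-unique {ℓ = ℓ} {m} w w′ w-geo w′-geo with ℕ.<-cmp ℓ m
  ... | tri< ℓ<m _ _ = ⊥-elim (w′-geo ℓ ℓ<m w)
  ... | tri≈ _ ℓ≡m _ = ℓ≡m
  ... | tri> _ _ m<ℓ = ⊥-elim (w-geo m m<ℓ w′)

  visible-refl : ∀ {X x} → Visible G X x x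
  visible-refl = 0 , nil , (λ _ ()) , tt

  visible-via : ∀ {X x m y} → x ≢ y → ¬ x ~ y → x ~ m → m ~ y → ¬ X m → Visible G X x y
  visible-via {x = x} {y = y} x≢y x≁y x~m m~y m∉X = 2 , walk , geodesic , m∉X , tt
    where
    walk : Walk G x y 2
    walk = cons x~m (cons m~y nil)

    geodesic : IsGeodesic G walk
    geodesic 0 _ nil = x≢y refl
    geodesic 1 _ (cons x~y nil) = x≁y x~y
    geodesic (suc (suc _)) (s≤s (s≤s ())) _

  IMVColouring⇒MVColouring : ∀ {k} → HasIMVColouring G k → HasMVColouring G k
  IMVColouring⇒MVColouring (c , imv) = c , proj₁ ∘ imv

module Subdivision {N : ℕ} (G : FinGraph N) where

  endpoints-injective : {e e′ : Edge G} → proj₁ e ≡ proj₁ e′ → e ≡ e′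
  endpoints-injective {_ , p , t} {_ , p′ , t′} refl
    rewrite <-irrelevant p p′ | T-irrelevant t t′ = refl

  data Joins : Edge G → Fin N → Fin N → Set where
    forward  : ∀ {a b p} → Joins ((a , b) , p) a b
    backward : ∀ {a b p} → Joins ((a , b) , p) b a

  joins-incidentˡ : ∀ {g a b} → Joins g a b → Incident G a g
  joins-incidentˡ forward  = inj₁ refl
  joins-incidentˡ backward = inj₂ refl

  joins-incidentʳ : ∀ {g a b} → Joins g a b → Incident G b g
  joins-incidentʳ forward  = inj₂ refl
  joins-incidentʳ backward = inj₁ refl

  joins-only : ∀ {g a b u} → Joins g a b → Incident G u g → u ≡ a ⊎ u ≡ b
  joins-only forward  (inj₁ refl) = inj₁ refl
  joins-only forward  (inj₂ refl) = inj₂ refl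
  joins-only backward (inj₁ refl) = inj₂ refl
  joins-only backward (inj₂ refl) = inj₁ refl

  incident⇒joins : ∀ {g x y} → Incident G x g → Incident G y g → x ≢ y → Joins g x y
  incident⇒joins {(_ , _) , _} (inj₁ refl) (inj₂ refl) _ = forward
  incident⇒joins {(_ , _) , _} (inj₂ refl) (inj₁ refl) _ = backward
  incident⇒joins (inj₁ refl) (inj₁ refl) x≢y = ⊥-elim (x≢y refl)
  incident⇒joins (inj₂ refl) (inj₂ refl) x≢y = ⊥-elim (x≢y refl)

  module _ {r} (f : Edge G → Fin r) where

    EdgeInClass⇒joins : ∀ {i a b} → EdgeInClass G f i a b → Σ (Edge G) λ g → Joins g a b × f g ≡ i
    EdgeInClass⇒joins (inj₁ (_ , _ , fg≡i)) = _ , forward , fg≡i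
    EdgeInClass⇒joins (inj₂ (_ , _ , fg≡i)) = _ , backward , fg≡i

    joins⇒EdgeInClass : ∀ {i g a b} → Joins g a b → f g ≡ i → EdgeInClass G f i a b
    joins⇒EdgeInClass (forward  {p = p , t}) fg≡i = inj₁ (p , t , fg≡i)
    joins⇒EdgeInClass (backward {p = p , t}) fg≡i = inj₂ (p , t , fg≡i)

    joins-colour : ∀ {i g a b} → Joins g a b → EdgeInClass G f i a b → f g ≡ i
    joins-colour {i} forward (inj₁ (_ , _ , fg≡i)) =
      subst (λ g → f g ≡ i) (endpoints-injective refl) fg≡i
    joins-colour (forward {p = p , _}) (inj₂ (q , _ , _)) = ⊥-elim (<-asym p q)
    joins-colour (backward {p = p , _}) (inj₁ (q , _ , _)) = ⊥-elim (<-asym p q)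
    joins-colour {i} backward (inj₂ (_ , _ , fg≡i)) =
      subst (λ g → f g ≡ i) (endpoints-injective refl) fg≡i

  Disjoint : Edge G → Edge G → Set
  Disjoint e e′ = ∀ u → Incident G u e → ¬ Incident G u e′

  disjoint⇒≢ : ∀ {e e′ x y} → Disjoint e e′ → Incident G x e → Incident G y e′ → x ≢ y
  disjoint⇒≢ disjoint x∈e y∈e′ refl = disjoint _ x∈e y∈e′

  shared-or-disjoint : (e e′ : Edge G) →
    (Σ (Fin N) λ u → Incident G u e × Incident G u e′) ⊎ Disjoint e e′
  shared-or-disjoint e@((a , b) , _) e′@((c , d) , _) with a ≟ c | a ≟ d | b ≟ c | b ≟ d
  ... | yes refl | _ | _ | _ = inj₁ (a , inj₁ refl , inj₁ refl)
  ... | _ | yes refl | _ | _ = inj₁ (a , inj₁ refl , inj₂ refl)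
  ... | _ | _ | yes refl | _ = inj₁ (b , inj₂ refl , inj₁ refl)
  ... | _ | _ | _ | yes refl = inj₁ (b , inj₂ refl , inj₂ refl)
  ... | no a≢c | no a≢d | no b≢c | no b≢d = inj₂ disjoint
    where
    disjoint : Disjoint e e′
    disjoint _ (inj₁ refl) (inj₁ refl) = a≢c refl
    disjoint _ (inj₁ refl) (inj₂ refl) = a≢d refl
    disjoint _ (inj₂ refl) (inj₁ refl) = b≢c refl
    disjoint _ (inj₂ refl) (inj₂ refl) = b≢d refl

  disjoint⇒distance≥4 : ∀ {e e′} → Disjoint e e′ →
    ∀ ℓ → ℓ < 4 → ¬ Walk (S G) (inj₂ e) (inj₂ e′) ℓ
  disjoint⇒distance≥4 {(a , _) , _} disjoint 0 _ nil = disjoint a (inj₁ refl) (inj₁ refl)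
  disjoint⇒distance≥4 disjoint 2 _ (cons {y = inj₁ u} u∈e (cons u∈e′ nil)) = disjoint u u∈e u∈e′
  disjoint⇒distance≥4 disjoint 3 _ (cons {y = inj₁ _} _ (cons {y = inj₂ _} _ (cons () nil)))
  disjoint⇒distance≥4 disjoint (suc (suc (suc (suc _)))) (s≤s (s≤s (s≤s (s≤s ())))) _

  walk₄ : ∀ {e e′ h x y} → Incident G x e → Incident G x h → Incident G y h → Incident G y e′ →
    Walk (S G) (inj₂ e) (inj₂ e′) 4
  walk₄ {h = h} {x} {y} x∈e x∈h y∈h y∈e′ =
    cons {y = inj₁ x} x∈e (cons {y = inj₂ h} x∈h (cons {y = inj₁ y} y∈h (cons y∈e′ nil)))

  visible-via₄ : ∀ {X e e′ h x y} → Disjoint e e′ →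
    Incident G x e → Incident G x h → Incident G y h → Incident G y e′ →
    ¬ X (inj₁ x) → ¬ X (inj₂ h) → ¬ X (inj₁ y) → Visible (S G) X (inj₂ e) (inj₂ e′)
  visible-via₄ disjoint x∈e x∈h y∈h y∈e′ x∉X h∉X y∉X =
    4 , walk₄ x∈e x∈h y∈h y∈e′ , disjoint⇒distance≥4 disjoint , x∉X , h∉X , y∉X , tt

  avoiding-walk₄-middle : ∀ {X e e′} (w : Walk (S G) (inj₂ e) (inj₂ e′) 4) →
    InternalAvoid (S G) X w →
    Σ (Edge G) λ h → ¬ X (inj₂ h) × Σ (Fin N) λ x → Σ (Fin N) λ y →
      Incident G x e × Incident G x h × Incident G y h × Incident G y e′
  avoiding-walk₄-middle
    (cons {y = inj₁ x} x∈e (cons {y = inj₂ h} x∈h (cons {y = inj₁ y} y∈h (cons y∈e′ nil))))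
    (_ , h∉X , _) = h , h∉X , x , y , x∈e , x∈h , y∈h , y∈e′

module _ {N k} {G : FinGraph N} (c : Graph.V (S G) → Fin k)
         (mv : ∀ i → IsMV (S G) (ColourClass (S G) c i)) where
  open Subdivision G

  MVColouring-edges-K4-free : ∀ i → ¬ ClassContainsK4 G (c ∘ inj₂) i
  MVColouring-edges-K4-free i
    (a , b , c′ , d , _ , a≢c , a≢d , b≢c , b≢d , _ , Eab , Eac , Ead , Ebc , Ebd , Ecd)
    with EdgeInClass⇒joins (c ∘ inj₂) Eab | EdgeInClass⇒joins (c ∘ inj₂) Ecd
       | EdgeInClass⇒joins (c ∘ inj₂) Eac
  ... | g , g-ab , g∈i | g′ , g′-cd , g′∈i | h , h-ac , _
    with mv i (inj₂ g) (inj₂ g′) g∈i g′∈i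
  ... | ℓ , w , w-geo , w-avoids =
    no-avoiding-walk₄ w (geodesic-length-unique (S G) w w₄ w-geo (disjoint⇒distance≥4 disjoint)) w-avoids
    where
    cross : ∀ {x y} → x ≡ a ⊎ x ≡ b → y ≡ c′ ⊎ y ≡ d → x ≢ y × EdgeInClass G (c ∘ inj₂) i x y
    cross (inj₁ refl) (inj₁ refl) = a≢c , Eac
    cross (inj₁ refl) (inj₂ refl) = a≢d , Ead
    cross (inj₂ refl) (inj₁ refl) = b≢c , Ebc
    cross (inj₂ refl) (inj₂ refl) = b≢d , Ebd

    disjoint : Disjoint g g′
    disjoint u u∈g u∈g′ = proj₁ (cross (joins-only g-ab u∈g) (joins-only g′-cd u∈g′)) refl

    w₄ : Walk (S G) (inj₂ g) (inj₂ g′) 4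
    w₄ = walk₄ {h = h} (joins-incidentˡ g-ab) (joins-incidentˡ h-ac)
                       (joins-incidentʳ h-ac) (joins-incidentˡ g′-cd)

    no-avoiding-walk₄ : ∀ {ℓ} (w : Walk (S G) (inj₂ g) (inj₂ g′) ℓ) → ℓ ≡ 4 →
      ¬ InternalAvoid (S G) (ColourClass (S G) c i) w
    no-avoiding-walk₄ w refl w-avoids with avoiding-walk₄-middle w w-avoids
    ... | m , m∉i , x , y , x∈g , x∈m , y∈m , y∈g′
      with cross (joins-only g-ab x∈g) (joins-only g′-cd y∈g′)
    ... | x≢y , Exy = m∉i (joins-colour (c ∘ inj₂) (incident⇒joins x∈m y∈m x≢y) Exy)

  MVColouring⇒K4FreePartition : HasK4FreePartition G k
  MVColouring⇒K4FreePartition = c ∘ inj₂ , MVColouring-edges-K4-free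

module _ {n : ℕ} where
  open Subdivision (K n)

  K-adjacent : ∀ {a b : Fin n} → a ≢ b → T (FinGraph.adj (K n) a b)
  K-adjacent {a} {b} a≢b with a ≟ b
  ... | yes a≡b = a≢b a≡b
  ... | no _ = tt

  K-edge : ∀ {a b : Fin n} → a ≢ b → Σ (Edge (K n)) λ g → Joins g a b
  K-edge {a} {b} a≢b with <-cmp a b
  ... | tri< a<b _ _ = ((a , b) , a<b , K-adjacent a≢b) , forward
  ... | tri≈ _ a≡b _ = ⊥-elim (a≢b a≡b)
  ... | tri> _ _ b<a = ((b , a) , b<a , K-adjacent (a≢b ∘ sym)) , backward

module _ {n r} (f : Edge (K n) → Fin r) (K4-free : ∀ i → ¬ ClassContainsK4 (K n) f i) where
  open Subdivision (K n)

  colour : Graph.V (S (K n)) → Fin (suc r)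
  colour (inj₁ _) = zero
  colour (inj₂ e) = suc (f e)

  private
    X : Fin (suc r) → Graph.V (S (K n)) → Set
    X = ColourClass (S (K n)) colour

  cross-edge-or-visible : ∀ {e e′ x y} → Disjoint e e′ → Incident (K n) x e → Incident (K n) y e′ →
    EdgeInClass (K n) f (f e) x y ⊎ Visible (S (K n)) (X (suc (f e))) (inj₂ e) (inj₂ e′)
  cross-edge-or-visible {e} {e′} disjoint x∈e y∈e′
    with K-edge (disjoint⇒≢ {e} {e′} disjoint x∈e y∈e′)
  ... | h , h-xy with f h ≟ f e
  ... | yes fh≡fe = inj₁ (joins⇒EdgeInClass f h-xy fh≡fe)
  ... | no fh≢fe = inj₂ (visible-via₄ disjoint x∈e (joins-incidentˡ h-xy) (joins-incidentʳ h-xy) y∈e′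
                          (λ ()) (fh≢fe ∘ suc-injective) (λ ()))

  disjoint-visible : ∀ {e e′} → f e′ ≡ f e → Disjoint e e′ →
    Visible (S (K n)) (X (suc (f e))) (inj₂ e) (inj₂ e′)
  disjoint-visible {e@((a , b) , a<b , _)} {e′@((c , d) , c<d , _)} fe′≡fe disjoint
    with cross-edge-or-visible disjoint (inj₁ refl) (inj₁ refl)
       | cross-edge-or-visible disjoint (inj₁ refl) (inj₂ refl)
       | cross-edge-or-visible disjoint (inj₂ refl) (inj₁ refl)
       | cross-edge-or-visible disjoint (inj₂ refl) (inj₂ refl)
  ... | inj₂ visible | _ | _ | _ = visible
  ... | _ | inj₂ visible | _ | _ = visible
  ... | _ | _ | inj₂ visible | _ = visible
  ... | _ | _ | _ | inj₂ visible = visible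
  ... | inj₁ Eac | inj₁ Ead | inj₁ Ebc | inj₁ Ebd = ⊥-elim (K4-free (f e)
    (a , b , c , d , <⇒≢ a<b , apart (inj₁ refl) (inj₁ refl) , apart (inj₁ refl) (inj₂ refl) ,
     apart (inj₂ refl) (inj₁ refl) , apart (inj₂ refl) (inj₂ refl) , <⇒≢ c<d ,
     joins⇒EdgeInClass f forward refl , Eac , Ead , Ebc , Ebd , joins⇒EdgeInClass f forward fe′≡fe))
    where
    apart : ∀ {x y} → Incident (K n) x e → Incident (K n) y e′ → x ≢ y
    apart = disjoint⇒≢ {e} {e′} disjoint

  vertices-visible : (u v : Fin n) → Visible (S (K n)) (X zero) (inj₁ u) (inj₁ v)
  vertices-visible u v with u ≟ v
  ... | yes refl = visible-refl (S (K n))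
  ... | no u≢v with K-edge u≢v
  ... | g , g-uv = visible-via (S (K n)) {m = inj₂ g} (λ { refl → u≢v refl }) (λ ())
                     (joins-incidentˡ g-uv) (joins-incidentʳ g-uv) (λ ())

  edges-visible : ∀ e e′ → f e′ ≡ f e → Visible (S (K n)) (X (suc (f e))) (inj₂ e) (inj₂ e′)
  edges-visible e e′ fe′≡fe with ≡-dec _≟_ _≟_ (proj₁ e) (proj₁ e′)
  ... | yes same = subst (Visible (S (K n)) (X (suc (f e))) (inj₂ e) ∘ inj₂) (endpoints-injective same)
                     (visible-refl (S (K n)))
  ... | no different with shared-or-disjoint e e′
  ... | inj₁ (u , u∈e , u∈e′) =
    visible-via (S (K n)) {m = inj₁ u} (λ { refl → different refl }) (λ ()) u∈e u∈e′ (λ ())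
  ... | inj₂ disjoint = disjoint-visible fe′≡fe disjoint

  colour-MV : ∀ i → IsMV (S (K n)) (X i)
  colour-MV _ (inj₁ u) (inj₁ v) refl refl = vertices-visible u v
  colour-MV _ (inj₂ e) (inj₂ e′) refl fe′≡fe = edges-visible e e′ (suc-injective fe′≡fe)
  colour-MV _ (inj₁ _) (inj₂ _) refl ()
  colour-MV _ (inj₂ _) (inj₁ _) refl ()

  colour-independent : ∀ i → IsIndependent (S (K n)) (X i)
  colour-independent _ (inj₁ _) (inj₂ _) refl () _
  colour-independent _ (inj₂ _) (inj₁ _) refl () _
  colour-independent _ (inj₁ _) (inj₁ _) _ _ ()
  colour-independent _ (inj₂ _) (inj₂ _) _ _ ()

  K4FreePartition⇒IMVColouring : HasIMVColouring (S (K n)) (suc r)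
  K4FreePartition⇒IMVColouring = colour , λ i → colour-MV i , colour-independent i

theorem2p1 : (n : ℕ) → 1 ≤ n → (ρ χμ χμi : ℕ) →
    IsLeast (HasK4FreePartition (K n)) ρ →
    IsLeast (HasMVColouring (S (K n))) χμ →
    IsLeast (HasIMVColouring (S (K n))) χμi →
    (ρ ≤ χμ) × (χμ ≤ χμi) × (χμi ≤ suc ρ)
theorem2p1 n _ ρ χμ χμi ((f , K4-free) , ρ-least) ((c , mv) , χμ-least) (imv , χμi-least) =
  ρ-least χμ (MVColouring⇒K4FreePartition c mv) ,
  χμ-least χμi (IMVColouring⇒MVColouring (S (K n)) imv) ,
  χμi-least (suc ρ) (K4FreePartition⇒IMVColouring f K4-free)
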